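{- Let $S=(N,M_0)$ be a live Petri net system. If the potential reachability graph of $S$ is initially directed, i.e. for every $M_1\in PR(S)$ there is a marking reachable both from $M_0$ and from $M_1$, then $S$ is strongly live, i.e. $(N,M)$ is live for every $M\in PR(S)$.
   Context: A Petri net is $N=(P,T,W)$ with finite disjoint sets $P$ (places), $T$ (transitions) and $W:(P\times T)\cup(T\times P)\to\mathbb{N}$. A marking is $M\in\mathbb{N}^P$; a system is $(N,M_0)$. Transition $t$ is enabled at $M$ if $M(p)\ge W(p,t)$ for all places $p$; firing it yields $M+I[\cdot,t]$ where the incidence matrix is $I(p,t)=W(t,p)-W(p,t)$. $R((N,M))$ denotes the set of markings reachable from $M$ by finite firing sequences. The system is live if for every transition $t$ and every $M\in R((N,M_0))$ there is $M'\in R((N,M))$ enabling $t$. $PR(S)=\{M\in\mathbb{N}^P : \exists Y\in\mathbb{N}^T,\ M=M_0+I\cdot Y\}$ is the set of potentially reachable markings; the potential reachability graph has vertex set $PR(S)$ with an arc $M\xrightarrow{t}M'$ whenever $M\in PR(S)$ enables $t$ and firing gives $M'$. -}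

module Defs where

open import Data.Nat using (ℕ; _+_; _∸_; _≤_)
open import Data.Integer as ℤ using (ℤ; +_)
open import Data.Fin using (Fin)
open import Data.Product using (Σ; ∃; _×_; _,_)
open import Relation.Binary.PropositionalEquality using (_≡_)

Σℤ : (n : ℕ) → (Fin n → ℤ) → ℤ
Σℤ ℕ.zero    f = + 0
Σℤ (ℕ.suc n) f = f Fin.zero ℤ.+ Σℤ n (λ i → f (Fin.suc i))

-- A Petri net N = (P, T, W) with P = Fin np, T = Fin nt (any finite sets).
record PetriNet : Set where
  field
    np  : ℕ
    nt  : ℕ
    Wpt : Fin np → Fin nt → ℕ
    Wtp : Fin nt → Fin np → ℕ
open PetriNet public

Marking : PetriNet → Set
Marking N = Fin (np N) → ℕ

Inc : (N : PetriNet) → Fin (np N) → Fin (nt N) → ℤ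
Inc N p t = (+ Wtp N t p) ℤ.- (+ Wpt N p t)

Enabled : (N : PetriNet) → Marking N → Fin (nt N) → Set
Enabled N M t = ∀ p → Wpt N p t ≤ M p

-- firing t at M yields M' (M'(p) = M(p) + I(p,t), computed in ℕ; valid when enabled)
fire : (N : PetriNet) → Marking N → Fin (nt N) → Marking N
fire N M t p = (M p ∸ Wpt N p t) + Wtp N t p

data Step (N : PetriNet) : Marking N → Fin (nt N) → Marking N → Set where
  step : ∀ {M t} → Enabled N M t → Step N M t (fire N M t)

data Reach (N : PetriNet) : Marking N → Marking N → Set where
  here  : ∀ {M} → Reach N M M
  there : ∀ {M t M₁ M'} → Step N M t M₁ → Reach N M₁ M' → Reach N M M'

Live : (N : PetriNet) → Marking N → Set
Live N M0 = ∀ (t : Fin (nt N)) (M : Marking N) → Reach N M0 M →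
            ∃ λ M' → Reach N M M' × Enabled N M' t

PR : (N : PetriNet) → Marking N → Marking N → Set
PR N M0 M = ∃ λ (Y : Fin (nt N) → ℕ) →
            ∀ p → + (M p) ≡ (+ M0 p) ℤ.+ Σℤ (nt N) (λ t → Inc N p t ℤ.* (+ Y t))

InitiallyDirected : (N : PetriNet) → Marking N → Set
InitiallyDirected N M0 = ∀ M₁ → PR N M0 M₁ →
  ∃ λ M → Reach N M0 M × Reach N M₁ M

StronglyLive : (N : PetriNet) → Marking N → Set
StronglyLive N M0 = ∀ M → PR N M0 M → Live N M

-- The key observation is that the set PR(S) of potentially reachable markings
-- is closed under firing: if M = M0 + I·Y and M --t--> M', then
-- M' = M + I[·,t] = M0 + I·(Y + e_t), where e_t is the unit vector of t.
-- Hence PR(S) is closed under reachability.  Now let M ∈ PR(S), let t be a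
-- transition and M' be reachable from M.  Then M' ∈ PR(S), so by initial
-- directedness some X is reachable both from M0 and from M'.  Liveness of
-- (N, M0) at X yields X' reachable from X enabling t, and X' is reachable
-- from M' by transitivity; so (N, M) is live.
module Submission where

open import Defs
open import Data.Nat as ℕ using (ℕ; _∸_)
open import Data.Integer as ℤ using (ℤ; +_)
import Data.Integer.Properties as ℤP
open import Data.Fin using (Fin; zero; suc)
open import Data.Product using (_,_)
open import Relation.Binary.PropositionalEquality
open ≡-Reasoning

reach-trans : ∀ {N A B C} → Reach N A B → Reach N B C → Reach N A C
reach-trans here        r = r
reach-trans (there s q) r = there s (reach-trans q r)

-- The unit vector e_t : Fin n → ℕ (Kronecker delta), by structural recursion
-- so that it computes on constructors.
unit : ∀ {n} → Fin n → Fin n → ℕ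
unit zero    zero    = 1
unit zero    (suc _) = 0
unit (suc _) zero    = 0
unit (suc t) (suc u) = unit t u

Σℤ-cong : ∀ n {f g : Fin n → ℤ} → (∀ i → f i ≡ g i) → Σℤ n f ≡ Σℤ n g
Σℤ-cong ℕ.zero    e = refl
Σℤ-cong (ℕ.suc n) e = cong₂ ℤ._+_ (e zero) (Σℤ-cong n (λ i → e (suc i)))

Σℤ-+ : ∀ n (f g : Fin n → ℤ) → Σℤ n (λ i → f i ℤ.+ g i) ≡ Σℤ n f ℤ.+ Σℤ n g
Σℤ-+ ℕ.zero    f g = refl
Σℤ-+ (ℕ.suc n) f g = begin
  (a ℤ.+ b) ℤ.+ Σℤ n (λ i → f (suc i) ℤ.+ g (suc i))
    ≡⟨ cong (λ z → (a ℤ.+ b) ℤ.+ z) (Σℤ-+ n (λ i → f (suc i)) (λ i → g (suc i))) ⟩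
  (a ℤ.+ b) ℤ.+ (F ℤ.+ G)   ≡⟨ ℤP.+-assoc a b (F ℤ.+ G) ⟩
  a ℤ.+ (b ℤ.+ (F ℤ.+ G))   ≡⟨ cong (λ z → a ℤ.+ z) (sym (ℤP.+-assoc b F G)) ⟩
  a ℤ.+ ((b ℤ.+ F) ℤ.+ G)   ≡⟨ cong (λ z → a ℤ.+ (z ℤ.+ G)) (ℤP.+-comm b F) ⟩
  a ℤ.+ ((F ℤ.+ b) ℤ.+ G)   ≡⟨ cong (λ z → a ℤ.+ z) (ℤP.+-assoc F b G) ⟩
  a ℤ.+ (F ℤ.+ (b ℤ.+ G))   ≡⟨ sym (ℤP.+-assoc a F (b ℤ.+ G)) ⟩
  (a ℤ.+ F) ℤ.+ (b ℤ.+ G)   ∎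
  where
    a = f zero
    b = g zero
    F = Σℤ n (λ i → f (suc i))
    G = Σℤ n (λ i → g (suc i))

Σℤ-zero : ∀ n (f : Fin n → ℤ) → Σℤ n (λ i → f i ℤ.* + 0) ≡ + 0
Σℤ-zero ℕ.zero    f = refl
Σℤ-zero (ℕ.suc n) f =
  cong₂ ℤ._+_ (ℤP.*-zeroʳ (f zero)) (Σℤ-zero n (λ i → f (suc i)))

Σℤ-unit : ∀ n (f : Fin n → ℤ) (t : Fin n) → Σℤ n (λ i → f i ℤ.* + unit t i) ≡ f t
Σℤ-unit (ℕ.suc n) f zero = begin
  f zero ℤ.* + 1 ℤ.+ Σℤ n (λ i → f (suc i) ℤ.* + 0)
    ≡⟨ cong₂ ℤ._+_ (ℤP.*-identityʳ (f zero)) (Σℤ-zero n (λ i → f (suc i))) ⟩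
  f zero ℤ.+ + 0   ≡⟨ ℤP.+-identityʳ (f zero) ⟩
  f zero           ∎
Σℤ-unit (ℕ.suc n) f (suc t) = begin
  f zero ℤ.* + 0 ℤ.+ Σℤ n (λ i → f (suc i) ℤ.* + unit t i)
    ≡⟨ cong₂ ℤ._+_ (ℤP.*-zeroʳ (f zero)) (Σℤ-unit n (λ i → f (suc i)) t) ⟩
  + 0 ℤ.+ f (suc t)   ≡⟨ ℤP.+-identityˡ (f (suc t)) ⟩
  f (suc t)           ∎

Σℤ-shift : ∀ n (f : Fin n → ℤ) (Y : Fin n → ℕ) (t : Fin n) →
  Σℤ n (λ i → f i ℤ.* + (Y i ℕ.+ unit t i)) ≡ Σℤ n (λ i → f i ℤ.* + Y i) ℤ.+ f t
Σℤ-shift n f Y t = begin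
  Σℤ n (λ i → f i ℤ.* + (Y i ℕ.+ unit t i))
    ≡⟨ Σℤ-cong n distrib ⟩
  Σℤ n (λ i → f i ℤ.* + Y i ℤ.+ f i ℤ.* + unit t i)
    ≡⟨ Σℤ-+ n (λ i → f i ℤ.* + Y i) (λ i → f i ℤ.* + unit t i) ⟩
  Σℤ n (λ i → f i ℤ.* + Y i) ℤ.+ Σℤ n (λ i → f i ℤ.* + unit t i)
    ≡⟨ cong (λ z → Σℤ n (λ i → f i ℤ.* + Y i) ℤ.+ z) (Σℤ-unit n f t) ⟩
  Σℤ n (λ i → f i ℤ.* + Y i) ℤ.+ f t ∎
  where
    distrib : ∀ i → f i ℤ.* + (Y i ℕ.+ unit t i) ≡ f i ℤ.* + Y i ℤ.+ f i ℤ.* + unit t i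
    distrib i = trans (cong (λ z → f i ℤ.* z) (ℤP.pos-+ (Y i) (unit t i)))
                      (ℤP.*-distribˡ-+ (f i) (+ Y i) (+ unit t i))

-- Firing an enabled transition adds the column I[·,t] of the incidence
-- matrix; enabledness makes the truncated subtraction in `fire` exact.
fire-Inc : ∀ N M t → Enabled N M t → ∀ p → + fire N M t p ≡ + M p ℤ.+ Inc N p t
fire-Inc N M t en p = begin
  + ((M p ∸ w) ℕ.+ v)          ≡⟨ ℤP.pos-+ (M p ∸ w) v ⟩
  + (M p ∸ w) ℤ.+ + v          ≡⟨ cong (λ z → z ℤ.+ + v) exact ⟩
  (+ M p ℤ.- + w) ℤ.+ + v      ≡⟨ ℤP.+-assoc (+ M p) (ℤ.- + w) (+ v) ⟩
  + M p ℤ.+ (ℤ.- + w ℤ.+ + v)  ≡⟨ cong (λ z → + M p ℤ.+ z) (ℤP.+-comm (ℤ.- + w) (+ v)) ⟩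
  + M p ℤ.+ Inc N p t          ∎
  where
    w = Wpt N p t
    v = Wtp N t p
    exact : + (M p ∸ w) ≡ + M p ℤ.- + w
    exact = sym (trans (ℤP.m-n≡m⊖n (M p) w) (ℤP.⊖-≥ (en p)))

-- PR(S) is closed under firing: the counting vector grows by e_t.
step-PR : ∀ N M0 {M t M'} → PR N M0 M → Step N M t M' → PR N M0 M'
step-PR N M0 {M} {t} (Y , eq) (step en) = (λ u → Y u ℕ.+ unit t u) , λ p → begin
  + fire N M t p                  ≡⟨ fire-Inc N M t en p ⟩
  + M p ℤ.+ Inc N p t             ≡⟨ cong (λ z → z ℤ.+ Inc N p t) (eq p) ⟩
  (+ M0 p ℤ.+ S p) ℤ.+ Inc N p t  ≡⟨ ℤP.+-assoc (+ M0 p) (S p) (Inc N p t) ⟩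
  + M0 p ℤ.+ (S p ℤ.+ Inc N p t)  ≡⟨ cong (λ z → + M0 p ℤ.+ z) (sym (Σℤ-shift (nt N) (Inc N p) Y t)) ⟩
  + M0 p ℤ.+ Σℤ (nt N) (λ u → Inc N p u ℤ.* + (Y u ℕ.+ unit t u)) ∎
  where
    S : Fin (np N) → ℤ
    S p = Σℤ (nt N) (λ u → Inc N p u ℤ.* + Y u)

reach-PR : ∀ N M0 {M M'} → PR N M0 M → Reach N M M' → PR N M0 M'
reach-PR N M0 pr here        = pr
reach-PR N M0 pr (there s r) = reach-PR N M0 (step-PR N M0 pr s) r

mainTheorem2 : (N : PetriNet) (M0 : Marking N) → Live N M0 → InitiallyDirected N M0 → StronglyLive N M0
mainTheorem2 N M0 live directed M pr t M' M→M'
  with directed M' (reach-PR N M0 pr M→M')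
... | X , M0→X , M'→X
  with live t X M0→X
... | X' , X→X' , enabled = X' , reach-trans M'→X X→X' , enabled
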